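{- Let $S\subseteq\mathbb{Z}^+$ and $r\ge0$. Then $$\sum_{n=0}^\infty \mathcal{D}_{n, S, r}\frac{x^n}{n!}=\frac{r!}{\bigl(1-\sum_{s\in S}x^s\bigr)^{r+1}}\Bigl(\sum_{s\in S}sx^{s-1}\Bigr)^r.$$
   Context: $\mathcal{D}_{n,S,r}$ is the number of doubly ordered partitions of $[n+r]$: sequences (ordered tuples) of non-empty lists (linearly ordered blocks) with pairwise disjoint label sets covering $[n+r]$, such that each list has size in $S$ and the elements $1,\dots,r$ lie in distinct lists. Identities are of formal power series. -}

module Defs where

open import Data.Bool using (Bool; true; false; if_then_else_)
open import Data.Nat as ℕ using (ℕ; zero; suc; _∸_; _≤_; _<_; _!; _≤?_; _<?_)
open import Data.Nat.Properties using (_!≢0)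
open import Data.Integer using (+_)
open import Data.Fin using (Fin; toℕ)
open import Data.Fin.Properties using (all?) renaming (_≟_ to _≟ᶠ_)
open import Data.List using (List; []; _∷_; map; concat; concatMap; length; filter; allFin)
open import Data.List.Relation.Unary.All using (All)
import Data.List.Relation.Unary.All as All
open import Data.List.Relation.Unary.Unique.Propositional using (Unique)
open import Data.List.Membership.Propositional using (_∈_)
import Data.List.Relation.Unary.Unique.DecPropositional as UniqueDec
import Data.List.Membership.DecPropositional as MemDec
open import Data.Product using (_×_)
open import Relation.Binary.PropositionalEquality using (_≡_; _≢_)
open import Relation.Unary using (Decidable)
open import Relation.Nullary using (Dec; ¬_)
open import Relation.Nullary.Decidable using (_×-dec_; ¬?)
open import Data.Bool.Properties using () renaming (_≟_ to _≟ᵇ_)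
open import Data.Rational using (ℚ; 0ℚ; _/_) renaming (_+_ to _+ℚ_; _*_ to _*ℚ_; _-_ to _-ℚ_)

-- Subsets S ⊆ ℤ⁺ are given by characteristic functions S : ℕ → Bool
-- (with the hypothesis S 0 ≡ false in the theorem).

-- Doubly ordered partitions of [m] (labels 1..m are Fin m, label j+1 ↦ j).
-- A candidate is a sequence (list) of lists of labels.

words : (m k : ℕ) → List (List (Fin m))
words m zero    = [] ∷ []
words m (suc k) = concatMap (λ i → map (i ∷_) (words m k)) (allFin m)

prod : {A : Set} → List (List A) → List (List A)
prod []         = [] ∷ []
prod (xs ∷ xss) = concatMap (λ x → map (x ∷_) (prod xss)) xs

-- compositions of n (lists of positive parts summing to n)
comps : ℕ → List (List ℕ)
comps zero    = [] ∷ []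
comps (suc n) = concatMap ext (comps n)
  where
  ext : List ℕ → List (List ℕ)
  ext []       = (1 ∷ []) ∷ []
  ext (p ∷ ps) = (suc p ∷ ps) ∷ (1 ∷ p ∷ ps) ∷ []

-- all sequences of non-empty lists of labels of total length m
-- (every doubly ordered partition of [m] occurs exactly once here)
candidates : (m : ℕ) → List (List (List (Fin m)))
candidates m = concatMap (λ c → prod (map (words m) c)) (comps m)

NonEmpty : {A : Set} → List A → Set
NonEmpty xs = 1 ≤ length xs

specials : {m : ℕ} (r : ℕ) → List (Fin m) → ℕ
specials r b = length (filter (λ i → toℕ i <? r) b)

-- The defining conditions of a doubly ordered partition of [m] with
-- block sizes in S and 1..r in distinct blocks:
--  * every block is non-empty,
--  * the blocks are linearly ordered lists with pairwise disjoint label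
--    sets (no label repeats in the concatenation),
--  * the blocks cover [m],
--  * every block size lies in S,
--  * each block contains at most one of the labels 1..r.
IsDOP : (S : ℕ → Bool) (r m : ℕ) → List (List (Fin m)) → Set
IsDOP S r m bs =
  All NonEmpty bs ×
  Unique (concat bs) ×
  (∀ i → i ∈ concat bs) ×
  All (λ b → S (length b) ≡ true) bs ×
  All (λ b → specials r b ≤ 1) bs

isDOP? : (S : ℕ → Bool) (r m : ℕ) → Decidable (IsDOP S r m)
isDOP? S r m bs =
  let open UniqueDec (_≟ᶠ_ {m}) using (unique?)
      open MemDec (_≟ᶠ_ {m}) using (_∈?_) in
  All.all? (λ b → 1 ≤? length b) bs ×-dec
  unique? (concat bs) ×-dec
  all? (λ i → i ∈? concat bs) ×-dec
  All.all? (λ b → S (length b) ≟ᵇ true) bs ×-dec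
  All.all? (λ b → specials r b ≤? 1) bs

𝒟 : (n : ℕ) (S : ℕ → Bool) (r : ℕ) → ℕ
𝒟 n S r = length (filter (isDOP? S r (n ℕ.+ r)) (candidates (n ℕ.+ r)))

FPS : Set
FPS = ℕ → ℚ

fromℕ : ℕ → ℚ
fromℕ k = (+ k) / 1

sumTo : ℕ → (ℕ → ℚ) → ℚ
sumTo zero    f = f 0
sumTo (suc n) f = sumTo n f +ℚ f (suc n)

_⊕_ : FPS → FPS → FPS
(f ⊕ g) n = f n +ℚ g n

_⊖_ : FPS → FPS → FPS
(f ⊖ g) n = f n -ℚ g n

_⊛_ : FPS → FPS → FPS
(f ⊛ g) n = sumTo n (λ k → f k *ℚ g (n ∸ k))

const : ℚ → FPS
const c zero    = c
const c (suc n) = 0ℚ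

one : FPS
one = const (fromℕ 1)

_^ˢ_ : FPS → ℕ → FPS
f ^ˢ zero  = one
f ^ˢ suc k = f ⊛ (f ^ˢ k)

sumS : (ℕ → Bool) → FPS
sumS S n = if S n then fromℕ 1 else 0ℚ

-- ∑_{s ∈ S} s x^{s-1}   (coefficient of x^n is (n+1)·[n+1 ∈ S])
dsumS : (ℕ → Bool) → FPS
dsumS S n = if S (suc n) then fromℕ (suc n) else 0ℚ

egf𝒟 : (ℕ → Bool) → ℕ → FPS
egf𝒟 S r n = (+ 𝒟 n S r) / (n !) where instance _ = n !≢0

{-# OPTIONS --safe #-}
-- Call the labels 1..r special and the other n ordinary, and let D(r, n) count the doubly
-- ordered partitions. Removing the first block gives
--   D(r, n) = [r = n = 0] + Σ_k [k ∈ S] n↓k D(r, n − k) + r Σ_k [k + 1 ∈ S] (k + 1) n↓k D(r − 1, n − k),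
-- as that block consists of k ordinary labels in some order (n↓k = n(n − 1)⋯(n − k + 1) ways),
-- possibly together with one of the r special labels at one of k + 1 positions. With
-- A = Σ_{s∈S} x^s, the exponential generating functions a_r of D(r, _) thus satisfy
-- a₀ (1 − A) = 1 and a_{r+1} (1 − A) = (r + 1) A′ a_r, so a_r (1 − A)^{r+1} = r! A′^r by
-- induction on r. The recurrence is read off the enumeration of candidates by counting the
-- ways to complete a partial partition: their number only depends on how many special and
-- ordinary labels are still unused.
module Submission where

open import Defs
open import Data.Bool using (Bool; true; false; _∧_; not; if_then_else_; T)
open import Data.Bool.Properties using (T-∧; T-≡; ∧-assoc)
open import Data.Nat as ℕ using (ℕ; zero; suc; _∸_; _≤_; _<_; z≤n; s≤s; _!; _⊓_; _<?_; _≡ᵇ_; _≤ᵇ_)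
open import Data.Nat.Properties using (_!≢0)
import Data.Nat.Properties as ℕP
import Data.Nat.Tactic.RingSolver as ℕSolver
import Algebra.Properties.CommutativeSemigroup ℕP.+-commutativeSemigroup as ℕ+
open import Algebra.Properties.Semiring.Sum ℕP.+-*-semiring using (sum; sum-cong-≗; sum-remove; ∑-distrib-+; *-distribʳ-sum)
open import Data.Integer as ℤ using ()
import Data.Integer.Properties as ℤP
open import Data.Rational as ℚ using (ℚ; 0ℚ; 1ℚ; toℚᵘ)
import Data.Rational.Properties as ℚP
open import Data.Rational.Unnormalised as ℚᵘ using (mkℚᵘ; *≡*)
import Data.Rational.Unnormalised.Properties as ℚᵘP
open import Data.Fin as Fin using (Fin; toℕ; punchIn; _≟_)
open import Data.Fin.Properties using (punchInᵢ≢i)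
open import Data.List using (List; []; _∷_; _++_; map; concat; concatMap; filter; length; allFin; tabulate)
open import Data.List.Relation.Unary.All as All using (All; []; _∷_)
open import Data.List.Relation.Unary.Any using (here; there)
open import Data.List.Relation.Unary.AllPairs using ([]; _∷_)
open import Data.List.Relation.Unary.Unique.Propositional using (Unique)
open import Data.List.Membership.Propositional using (_∈_; _∉_)
open import Data.Product using (_×_; _,_; proj₁; proj₂)
open import Data.Empty using (⊥-elim)
open import Function using (_∘_)
open import Function.Bundles using (_⇔_; mk⇔; Equivalence)
open import Level using (0ℓ)
open import Relation.Nullary using (Dec; yes; no; does; ¬_; contradiction)
open import Relation.Nullary.Decidable using (dec⇒maybe; decidable-stable)
open import Relation.Unary using (Pred; Decidable)
open import Relation.Binary.PropositionalEquality
import Relation.Binary.Reasoning.Setoid as SetoidReasoning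
open import Tactic.RingSolver using (solve-∀)
open import Tactic.RingSolver.Core.AlmostCommutativeRing using (AlmostCommutativeRing; fromCommutativeRing)

ℚ-ring : AlmostCommutativeRing 0ℓ 0ℓ
ℚ-ring = fromCommutativeRing ℚP.+-*-commutativeRing (λ x → dec⇒maybe (0ℚ ℚP.≟ x))

module _ where
  open ℚᵘP.≃-Reasoning

  toℚᵘ-fromℕ : ∀ a → toℚᵘ (fromℕ a) ℚᵘ.≃ mkℚᵘ (ℤ.+ a) 0
  toℚᵘ-fromℕ a = ℚP.toℚᵘ-fromℚᵘ (mkℚᵘ (ℤ.+ a) 0)

  fromℕ-+ : ∀ a b → fromℕ (a ℕ.+ b) ≡ fromℕ a ℚ.+ fromℕ b
  fromℕ-+ a b = ℚP.toℚᵘ-injective (begin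
    toℚᵘ (fromℕ (a ℕ.+ b))                  ≈⟨ toℚᵘ-fromℕ (a ℕ.+ b) ⟩
    mkℚᵘ (ℤ.+ (a ℕ.+ b)) 0                  ≈⟨ *≡* (cong (ℤ._* ℤ.+ 1) (trans (ℤP.pos-+ a b) numerators)) ⟩
    mkℚᵘ (ℤ.+ a) 0 ℚᵘ.+ mkℚᵘ (ℤ.+ b) 0      ≈⟨ ℚᵘP.+-cong (toℚᵘ-fromℕ a) (toℚᵘ-fromℕ b) ⟨
    toℚᵘ (fromℕ a) ℚᵘ.+ toℚᵘ (fromℕ b)      ≈⟨ ℚP.toℚᵘ-homo-+ (fromℕ a) (fromℕ b) ⟨
    toℚᵘ (fromℕ a ℚ.+ fromℕ b)              ∎)
    where
    numerators : ℤ.+ a ℤ.+ ℤ.+ b ≡ ℤ.+ a ℤ.* ℤ.+ 1 ℤ.+ ℤ.+ b ℤ.* ℤ.+ 1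
    numerators = sym (cong₂ ℤ._+_ (ℤP.*-identityʳ (ℤ.+ a)) (ℤP.*-identityʳ (ℤ.+ b)))

  fromℕ-* : ∀ a b → fromℕ (a ℕ.* b) ≡ fromℕ a ℚ.* fromℕ b
  fromℕ-* a b = ℚP.toℚᵘ-injective (begin
    toℚᵘ (fromℕ (a ℕ.* b))                  ≈⟨ toℚᵘ-fromℕ (a ℕ.* b) ⟩
    mkℚᵘ (ℤ.+ (a ℕ.* b)) 0                  ≈⟨ *≡* (cong (ℤ._* ℤ.+ 1) (ℤP.pos-* a b)) ⟩
    mkℚᵘ (ℤ.+ a) 0 ℚᵘ.* mkℚᵘ (ℤ.+ b) 0      ≈⟨ ℚᵘP.*-cong (toℚᵘ-fromℕ a) (toℚᵘ-fromℕ b) ⟨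
    toℚᵘ (fromℕ a) ℚᵘ.* toℚᵘ (fromℕ b)      ≈⟨ ℚP.toℚᵘ-homo-* (fromℕ a) (fromℕ b) ⟨
    toℚᵘ (fromℕ a ℚ.* fromℕ b)              ∎)

  1/ℕ_ : (m : ℕ) .{{_ : ℕ.NonZero m}} → ℚ
  1/ℕ m = (ℤ.+ 1) ℚ./ m

  /≡*1/ℕ : ∀ a m .{{_ : ℕ.NonZero m}} → (ℤ.+ a) ℚ./ m ≡ fromℕ a ℚ.* 1/ℕ m
  /≡*1/ℕ a m@(suc d) = ℚP.toℚᵘ-injective (begin
    toℚᵘ ((ℤ.+ a) ℚ./ m)                    ≈⟨ ℚP.toℚᵘ-fromℚᵘ (mkℚᵘ (ℤ.+ a) d) ⟩
    mkℚᵘ (ℤ.+ a) d                          ≈⟨ *≡* (trans (cong ((ℤ.+ a ℤ.*_) ∘ ℤ.+_ ∘ suc) (ℕP.+-identityʳ d))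
                                                          (cong (ℤ._* ℤ.+ m) (sym (ℤP.*-identityʳ (ℤ.+ a))))) ⟩
    mkℚᵘ (ℤ.+ a) 0 ℚᵘ.* mkℚᵘ (ℤ.+ 1) d      ≈⟨ ℚᵘP.*-cong (toℚᵘ-fromℕ a) (ℚP.toℚᵘ-fromℚᵘ (mkℚᵘ (ℤ.+ 1) d)) ⟨
    toℚᵘ (fromℕ a) ℚᵘ.* toℚᵘ (1/ℕ m)        ≈⟨ ℚP.toℚᵘ-homo-* (fromℕ a) (1/ℕ m) ⟨
    toℚᵘ (fromℕ a ℚ.* 1/ℕ m)                ∎)

  fromℕ*1/ℕ : ∀ m .{{_ : ℕ.NonZero m}} → fromℕ m ℚ.* 1/ℕ m ≡ 1ℚ
  fromℕ*1/ℕ m@(suc d) = ℚP.toℚᵘ-injective (begin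
    toℚᵘ (fromℕ m ℚ.* 1/ℕ m)                ≈⟨ ℚP.toℚᵘ-homo-* (fromℕ m) (1/ℕ m) ⟩
    toℚᵘ (fromℕ m) ℚᵘ.* toℚᵘ (1/ℕ m)        ≈⟨ ℚᵘP.*-cong (toℚᵘ-fromℕ m) (ℚP.toℚᵘ-fromℚᵘ (mkℚᵘ (ℤ.+ 1) d)) ⟩
    mkℚᵘ (ℤ.+ m) 0 ℚᵘ.* mkℚᵘ (ℤ.+ 1) d      ≈⟨ *≡* (trans (ℤP.*-identityʳ _)
                                                          (trans (ℤP.*-identityʳ (ℤ.+ m)) (cong (ℤ.+_ ∘ suc) (unit-denominator d)))) ⟩
    ℚᵘ.1ℚᵘ                                  ∎)
    where
    unit-denominator : ∀ d → d ≡ d ℕ.+ 0 ℕ.* suc d ℕ.+ 0 ℕ.* suc (d ℕ.+ 0 ℕ.* suc d)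
    unit-denominator = ℕSolver.solve-∀

-- The Cauchy product

module _ where
  open import Data.Rational using (_+_; _*_; _-_; -_)
  open ≡-Reasoning

  sumTo-cong : ∀ n {f g : ℕ → ℚ} → (∀ k → k ≤ n → f k ≡ g k) → sumTo n f ≡ sumTo n g
  sumTo-cong zero    f≡g = f≡g 0 z≤n
  sumTo-cong (suc n) f≡g =
    cong₂ _+_ (sumTo-cong n (λ k k≤n → f≡g k (ℕP.m≤n⇒m≤1+n k≤n))) (f≡g (suc n) ℕP.≤-refl)

  sumTo-+ : ∀ n (f g : ℕ → ℚ) → sumTo n (λ k → f k + g k) ≡ sumTo n f + sumTo n g
  sumTo-+ zero    f g = refl
  sumTo-+ (suc n) f g = trans (cong (_+ (f (suc n) + g (suc n))) (sumTo-+ n f g))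
                              (interchange (sumTo n f) (sumTo n g) (f (suc n)) (g (suc n)))
    where
    interchange : ∀ a b c d → (a + b) + (c + d) ≡ (a + c) + (b + d)
    interchange = solve-∀ ℚ-ring

  sumTo-*ˡ : ∀ n c (f : ℕ → ℚ) → sumTo n (λ k → c * f k) ≡ c * sumTo n f
  sumTo-*ˡ zero    c f = refl
  sumTo-*ˡ (suc n) c f = trans (cong (_+ c * f (suc n)) (sumTo-*ˡ n c f)) (sym (ℚP.*-distribˡ-+ c (sumTo n f) (f (suc n))))

  sumTo-*ʳ : ∀ n c (f : ℕ → ℚ) → sumTo n (λ k → f k * c) ≡ sumTo n f * c
  sumTo-*ʳ zero    c f = refl
  sumTo-*ʳ (suc n) c f = trans (cong (_+ f (suc n) * c) (sumTo-*ʳ n c f)) (sym (ℚP.*-distribʳ-+ c (sumTo n f) (f (suc n))))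

  sumTo-- : ∀ n (f g : ℕ → ℚ) → sumTo n (λ k → f k - g k) ≡ sumTo n f - sumTo n g
  sumTo-- zero    f g = refl
  sumTo-- (suc n) f g = trans (cong (_+ (f (suc n) - g (suc n))) (sumTo-- n f g))
                              (interchange (sumTo n f) (sumTo n g) (f (suc n)) (g (suc n)))
    where
    interchange : ∀ a b c d → (a - b) + (c - d) ≡ (a + c) - (b + d)
    interchange = solve-∀ ℚ-ring

  sumTo-suc : ∀ n (f : ℕ → ℚ) → sumTo (suc n) f ≡ f 0 + sumTo n (f ∘ suc)
  sumTo-suc zero    f = refl
  sumTo-suc (suc n) f = trans (cong (_+ f (suc (suc n))) (sumTo-suc n f)) (ℚP.+-assoc (f 0) _ _)

  sumTo-reverse : ∀ n (f : ℕ → ℚ) → sumTo n f ≡ sumTo n (λ k → f (n ∸ k))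
  sumTo-reverse zero    f = refl
  sumTo-reverse (suc n) f = begin
    sumTo n f + f (suc n)                        ≡⟨ cong (_+ f (suc n)) (sumTo-reverse n f) ⟩
    sumTo n (λ k → f (n ∸ k)) + f (suc n)        ≡⟨ ℚP.+-comm _ (f (suc n)) ⟩
    f (suc n) + sumTo n (λ k → f (n ∸ k))        ≡⟨ sumTo-suc n (λ k → f (suc n ∸ k)) ⟨
    sumTo (suc n) (λ k → f (suc n ∸ k))          ∎

  sumTo-triangle : ∀ n (F : ℕ → ℕ → ℚ) →
    sumTo n (λ k → sumTo k (λ j → F j k)) ≡ sumTo n (λ j → sumTo (n ∸ j) (λ i → F j (j ℕ.+ i)))
  sumTo-triangle zero    F = refl
  sumTo-triangle (suc n) F = begin
    sumTo n (λ k → sumTo k (λ j → F j k)) + (sumTo n (λ j → F j (suc n)) + F (suc n) (suc n))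
      ≡⟨ cong (_+ (sumTo n (λ j → F j (suc n)) + F (suc n) (suc n))) (sumTo-triangle n F) ⟩
    Rows n + (sumTo n (λ j → F j (suc n)) + F (suc n) (suc n))
      ≡⟨ ℚP.+-assoc (Rows n) _ _ ⟨
    (Rows n + sumTo n (λ j → F j (suc n))) + F (suc n) (suc n)
      ≡⟨ cong₂ _+_ (sym (sumTo-+ n _ _)) (cong (F (suc n)) (sym (ℕP.+-identityʳ (suc n)))) ⟩
    sumTo n (λ j → sumTo (n ∸ j) (λ i → F j (j ℕ.+ i)) + F j (suc n)) + F (suc n) (suc n ℕ.+ 0)
      ≡⟨ cong₂ _+_ (sumTo-cong n (λ j j≤n → sym (extendRow j j≤n)))
                   (cong (λ t → sumTo t (λ i → F (suc n) (suc n ℕ.+ i))) (sym (ℕP.n∸n≡0 n))) ⟩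
    sumTo n (λ j → sumTo (suc n ∸ j) (λ i → F j (j ℕ.+ i))) + sumTo (suc n ∸ suc n) (λ i → F (suc n) (suc n ℕ.+ i))
      ∎
    where
    Rows : ℕ → ℚ
    Rows m = sumTo n (λ j → sumTo (m ∸ j) (λ i → F j (j ℕ.+ i)))
    extendRow : ∀ j → j ≤ n →
      sumTo (suc n ∸ j) (λ i → F j (j ℕ.+ i)) ≡ sumTo (n ∸ j) (λ i → F j (j ℕ.+ i)) + F j (suc n)
    extendRow j j≤n rewrite ℕP.+-∸-assoc 1 j≤n = cong (λ k → sumTo (n ∸ j) (λ i → F j (j ℕ.+ i)) + F j k)
                                                        (trans (ℕP.+-suc j (n ∸ j)) (cong suc (ℕP.m+[n∸m]≡n j≤n)))

  infixr 7 _·_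
  _·_ : ℚ → FPS → FPS
  (c · f) n = c * f n

  ⊛-congˡ : ∀ {f f′} g → f ≗ f′ → f ⊛ g ≗ f′ ⊛ g
  ⊛-congˡ g f≗f′ n = sumTo-cong n (λ k _ → cong (_* g (n ∸ k)) (f≗f′ k))

  ⊛-congʳ : ∀ f {g g′} → g ≗ g′ → f ⊛ g ≗ f ⊛ g′
  ⊛-congʳ f g≗g′ n = sumTo-cong n (λ k _ → cong (f k *_) (g≗g′ (n ∸ k)))

  ·-congʳ : ∀ c {f g} → f ≗ g → c · f ≗ c · g
  ·-congʳ c f≗g n = cong (c *_) (f≗g n)

  ⊛-comm : ∀ f g → f ⊛ g ≗ g ⊛ f
  ⊛-comm f g n = trans (sumTo-reverse n _) (sumTo-cong n (λ k k≤n →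
    trans (cong (λ i → f (n ∸ k) * g i) (ℕP.m∸[m∸n]≡n k≤n)) (ℚP.*-comm (f (n ∸ k)) (g k))))

  ⊛-assoc : ∀ f g h → (f ⊛ g) ⊛ h ≗ f ⊛ (g ⊛ h)
  ⊛-assoc f g h n = begin
    sumTo n (λ k → sumTo k (λ j → f j * g (k ∸ j)) * h (n ∸ k))
      ≡⟨ sumTo-cong n (λ k _ → sym (sumTo-*ʳ k (h (n ∸ k)) _)) ⟩
    sumTo n (λ k → sumTo k (λ j → f j * g (k ∸ j) * h (n ∸ k)))
      ≡⟨ sumTo-triangle n (λ j k → f j * g (k ∸ j) * h (n ∸ k)) ⟩
    sumTo n (λ j → sumTo (n ∸ j) (λ i → f j * g ((j ℕ.+ i) ∸ j) * h (n ∸ (j ℕ.+ i))))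
      ≡⟨ sumTo-cong n (λ j _ → sumTo-cong (n ∸ j) (λ i _ → reindex j i)) ⟩
    sumTo n (λ j → sumTo (n ∸ j) (λ i → f j * (g i * h (n ∸ j ∸ i))))
      ≡⟨ sumTo-cong n (λ j _ → sumTo-*ˡ (n ∸ j) (f j) _) ⟩
    sumTo n (λ j → f j * sumTo (n ∸ j) (λ i → g i * h (n ∸ j ∸ i)))
      ∎
    where
    reindex : ∀ j i → f j * g ((j ℕ.+ i) ∸ j) * h (n ∸ (j ℕ.+ i)) ≡ f j * (g i * h (n ∸ j ∸ i))
    reindex j i = trans (cong₂ (λ a b → f j * g a * h b) (ℕP.m+n∸m≡n j i) (sym (ℕP.∸-+-assoc n j i)))
                        (ℚP.*-assoc (f j) (g i) (h (n ∸ j ∸ i)))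

  ⊛-constˡ : ∀ c g → const c ⊛ g ≗ c · g
  ⊛-constˡ c g zero    = refl
  ⊛-constˡ c g (suc n) = begin
    sumTo (suc n) (λ k → const c k * g (suc n ∸ k))   ≡⟨ sumTo-suc n _ ⟩
    c * g (suc n) + sumTo n (λ k → 0ℚ * g (n ∸ k))    ≡⟨ cong (c * g (suc n) +_) (sumTo-*ˡ n 0ℚ rest) ⟩
    c * g (suc n) + 0ℚ * sumTo n rest                 ≡⟨ cong (c * g (suc n) +_) (ℚP.*-zeroˡ (sumTo n rest)) ⟩
    c * g (suc n) + 0ℚ                                ≡⟨ ℚP.+-identityʳ _ ⟩
    c * g (suc n)                                     ∎
    where
    rest : ℕ → ℚ
    rest k = g (n ∸ k)

  ⊛-identityˡ : ∀ g → one ⊛ g ≗ g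
  ⊛-identityˡ g n = trans (⊛-constˡ _ g n) (ℚP.*-identityˡ (g n))

  ⊛-identityʳ : ∀ f → f ⊛ one ≗ f
  ⊛-identityʳ f n = trans (⊛-comm f one n) (⊛-identityˡ f n)

  ⊛-distribˡ-⊖ : ∀ f g h → f ⊛ (g ⊖ h) ≗ (f ⊛ g) ⊖ (f ⊛ h)
  ⊛-distribˡ-⊖ f g h n =
    trans (sumTo-cong n (λ k _ → distrib (f k) (g (n ∸ k)) (h (n ∸ k)))) (sumTo-- n _ _)
    where
    distrib : ∀ a b c → a * (b - c) ≡ a * b - a * c
    distrib = solve-∀ ℚ-ring

  ·-⊛ˡ : ∀ c f g → (c · f) ⊛ g ≗ c · (f ⊛ g)
  ·-⊛ˡ c f g n = trans (sumTo-cong n (λ k _ → ℚP.*-assoc c (f k) (g (n ∸ k)))) (sumTo-*ˡ n c _)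

  ·-⊛ʳ : ∀ c f g → f ⊛ (c · g) ≗ c · (f ⊛ g)
  ·-⊛ʳ c f g n = trans (sumTo-cong n (λ k _ → swap (f k) c (g (n ∸ k)))) (sumTo-*ˡ n c _)
    where
    swap : ∀ a b d → a * (b * d) ≡ b * (a * d)
    swap = solve-∀ ℚ-ring

  ·-· : ∀ c d f → c · (d · f) ≗ (c * d) · f
  ·-· c d f n = sym (ℚP.*-assoc c d (f n))

  ⊛-[one⊖]-cancel : ∀ {f} g A → f ≗ g ⊕ (A ⊛ f) → f ⊛ (one ⊖ A) ≗ g
  ⊛-[one⊖]-cancel {f} g A f≗g+Af n = begin
    (f ⊛ (one ⊖ A)) n          ≡⟨ ⊛-distribˡ-⊖ f one A n ⟩
    (f ⊛ one) n - (f ⊛ A) n    ≡⟨ cong₂ _-_ (trans (⊛-identityʳ f n) (f≗g+Af n)) (⊛-comm f A n) ⟩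
    g n + (A ⊛ f) n - (A ⊛ f) n ≡⟨ cancel (g n) ((A ⊛ f) n) ⟩
    g n                         ∎
    where
    cancel : ∀ x y → x + y - y ≡ x
    cancel = solve-∀ ℚ-ring

-- Solving the recurrence of the generating functions

module _ (A A′ : FPS) (a : ℕ → FPS)
         (a₀-rec : a 0 ≗ one ⊕ (A ⊛ a 0))
         (a₊-rec : ∀ r → a (suc r) ≗ (fromℕ (suc r) · (A′ ⊛ a r)) ⊕ (A ⊛ a (suc r))) where
  open SetoidReasoning (ℕ →-setoid ℚ)

  ⊛-[one⊖]^-closedForm : ∀ r → a r ⊛ ((one ⊖ A) ^ˢ suc r) ≗ fromℕ (r !) · (A′ ^ˢ r)
  ⊛-[one⊖]^-closedForm zero = begin
    a 0 ⊛ ((one ⊖ A) ⊛ one)   ≈⟨ ⊛-congʳ (a 0) (⊛-identityʳ (one ⊖ A)) ⟩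
    a 0 ⊛ (one ⊖ A)           ≈⟨ ⊛-[one⊖]-cancel one A a₀-rec ⟩
    one                       ≈⟨ (λ n → sym (ℚP.*-identityˡ (one n))) ⟩
    fromℕ 1 · one             ∎
  ⊛-[one⊖]^-closedForm (suc r) = begin
    a (suc r) ⊛ (B ⊛ B^[1+r])                  ≈⟨ ⊛-assoc (a (suc r)) B B^[1+r] ⟨
    (a (suc r) ⊛ B) ⊛ B^[1+r]                  ≈⟨ ⊛-congˡ B^[1+r] (⊛-[one⊖]-cancel (c · (A′ ⊛ a r)) A (a₊-rec r)) ⟩
    (c · (A′ ⊛ a r)) ⊛ B^[1+r]                 ≈⟨ ·-⊛ˡ c (A′ ⊛ a r) B^[1+r] ⟩
    c · ((A′ ⊛ a r) ⊛ B^[1+r])                 ≈⟨ ·-congʳ c (⊛-assoc A′ (a r) B^[1+r]) ⟩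
    c · (A′ ⊛ (a r ⊛ B^[1+r]))                 ≈⟨ ·-congʳ c (⊛-congʳ A′ (⊛-[one⊖]^-closedForm r)) ⟩
    c · (A′ ⊛ (fromℕ (r !) · (A′ ^ˢ r)))       ≈⟨ ·-congʳ c (·-⊛ʳ (fromℕ (r !)) A′ (A′ ^ˢ r)) ⟩
    c · (fromℕ (r !) · (A′ ⊛ (A′ ^ˢ r)))       ≈⟨ ·-· c (fromℕ (r !)) (A′ ^ˢ suc r) ⟩
    (c ℚ.* fromℕ (r !)) · (A′ ^ˢ suc r)        ≈⟨ (λ n → cong (ℚ._* (A′ ^ˢ suc r) n) (fromℕ-* (suc r) (r !))) ⟨
    fromℕ (suc r !) · (A′ ^ˢ suc r)            ∎
    where
    B B^[1+r] : FPS
    B = one ⊖ A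
    B^[1+r] = B ^ˢ suc r
    c : ℚ
    c = fromℕ (suc r)

-- Falling factorials and exponential generating functions

infixl 8 _↓_
_↓_ : ℕ → ℕ → ℕ
q ↓ zero  = 1
q ↓ suc k = q ℕ.* (q ∸ 1) ↓ k

↓-*-! : ∀ {n k} → k ≤ n → n ↓ k ℕ.* (n ∸ k) ! ≡ n !
↓-*-! {n}     {zero}  _         = ℕP.+-identityʳ (n !)
↓-*-! {suc n} {suc k} (s≤s k≤n) = trans (ℕP.*-assoc (suc n) (n ↓ k) ((n ∸ k) !)) (cong (suc n ℕ.*_) (↓-*-! k≤n))

<⇒↓≡0 : ∀ {q k} → q < k → q ↓ k ≡ 0
<⇒↓≡0 {zero}  {suc k} _         = refl
<⇒↓≡0 {suc q} {suc k} (s≤s q<k) = trans (cong (suc q ℕ.*_) (<⇒↓≡0 q<k)) (ℕP.*-zeroʳ (suc q))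

sumℕ : ℕ → (ℕ → ℕ) → ℕ
sumℕ zero    f = f 0
sumℕ (suc n) f = sumℕ n f ℕ.+ f (suc n)

module _ where
  open import Data.Nat using (_+_; _*_)
  open ≡-Reasoning

  sumℕ-cong : ∀ n {f g : ℕ → ℕ} → (∀ k → k ≤ n → f k ≡ g k) → sumℕ n f ≡ sumℕ n g
  sumℕ-cong zero    f≡g = f≡g 0 z≤n
  sumℕ-cong (suc n) f≡g =
    cong₂ _+_ (sumℕ-cong n (λ k k≤n → f≡g k (ℕP.m≤n⇒m≤1+n k≤n))) (f≡g (suc n) ℕP.≤-refl)

  sumℕ-+ : ∀ n (f g : ℕ → ℕ) → sumℕ n (λ k → f k + g k) ≡ sumℕ n f + sumℕ n g
  sumℕ-+ zero    f g = refl
  sumℕ-+ (suc n) f g = trans (cong (_+ (f (suc n) + g (suc n))) (sumℕ-+ n f g))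
                             (ℕ+.interchange (sumℕ n f) (sumℕ n g) (f (suc n)) (g (suc n)))

  sumℕ-*ˡ : ∀ n c (f : ℕ → ℕ) → sumℕ n (λ k → c * f k) ≡ c * sumℕ n f
  sumℕ-*ˡ zero    c f = refl
  sumℕ-*ˡ (suc n) c f = trans (cong (_+ c * f (suc n)) (sumℕ-*ˡ n c f)) (sym (ℕP.*-distribˡ-+ c (sumℕ n f) (f (suc n))))

  sumℕ-suc : ∀ n (f : ℕ → ℕ) → sumℕ (suc n) f ≡ f 0 + sumℕ n (f ∘ suc)
  sumℕ-suc zero    f = refl
  sumℕ-suc (suc n) f = trans (cong (_+ f (suc (suc n))) (sumℕ-suc n f)) (ℕP.+-assoc (f 0) _ _)

  sumℕ-extend : ∀ {n L} (f : ℕ → ℕ) → n ≤ L → (∀ k → n < k → f k ≡ 0) → sumℕ L f ≡ sumℕ n f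
  sumℕ-extend {n} {L} f n≤L f≡0 with ℕP.m≤n⇒∃[o]m+o≡n n≤L
  ... | d , refl = extend d
    where
    extend : ∀ d → sumℕ (n + d) f ≡ sumℕ n f
    extend zero    = cong (λ t → sumℕ t f) (ℕP.+-identityʳ n)
    extend (suc d) rewrite ℕP.+-suc n d =
      trans (cong₂ _+_ (extend d) (f≡0 (suc (n + d)) (s≤s (ℕP.m≤m+n n d)))) (ℕP.+-identityʳ _)

  fromℕ-sumℕ : ∀ n (f : ℕ → ℕ) → fromℕ (sumℕ n f) ≡ sumTo n (fromℕ ∘ f)
  fromℕ-sumℕ zero    f = refl
  fromℕ-sumℕ (suc n) f = trans (fromℕ-+ (sumℕ n f) (f (suc n))) (cong (ℚ._+ fromℕ (f (suc n))) (fromℕ-sumℕ n f))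

infixl 7 _⋆_
_⋆_ : (ℕ → ℕ) → (ℕ → ℕ) → ℕ → ℕ
(g ⋆ e) n = sumℕ n (λ k → g k ℕ.* n ↓ k ℕ.* e (n ∸ k))

⋆-extend : ∀ g e {n L} → n ≤ L → (g ⋆ e) n ≡ sumℕ L (λ k → g k ℕ.* n ↓ k ℕ.* e (n ∸ k))
⋆-extend g e {n} n≤L = sym (sumℕ-extend _ n≤L (λ k n<k →
  trans (cong (λ x → g k ℕ.* x ℕ.* e (n ∸ k)) (<⇒↓≡0 n<k)) (cong (ℕ._* e (n ∸ k)) (ℕP.*-zeroʳ (g k)))))

infix 10 _!⁻¹
_!⁻¹ : ℕ → ℚ
n !⁻¹ = 1/ℕ (n !) where instance _ = n !≢0

egf : (ℕ → ℕ) → FPS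
egf e n = (ℤ.+ e n) ℚ./ (n !) where instance _ = n !≢0

module _ where
  open import Data.Rational using (_*_)
  open ≡-Reasoning

  egf≡*!⁻¹ : ∀ e n → egf e n ≡ fromℕ (e n) * n !⁻¹
  egf≡*!⁻¹ e n = /≡*1/ℕ (e n) (n !) {{n !≢0}}

  !⁻¹-↓ : ∀ {n k} → k ≤ n → (n ∸ k) !⁻¹ ≡ fromℕ (n ↓ k) * n !⁻¹
  !⁻¹-↓ {n} {k} k≤n = begin
    x                      ≡⟨ ℚP.*-identityʳ x ⟨
    x * 1ℚ                 ≡⟨ cong (x *_) (fromℕ*1/ℕ (n !) {{n !≢0}}) ⟨
    x * (fromℕ (n !) * y)  ≡⟨ cong (λ t → x * (fromℕ t * y)) (↓-*-! k≤n) ⟨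
    x * (fromℕ (F ℕ.* G) * y) ≡⟨ cong (λ t → x * (t * y)) (fromℕ-* F G) ⟩
    x * (fromℕ F * fromℕ G * y) ≡⟨ rearrange x y (fromℕ F) (fromℕ G) ⟩
    fromℕ F * y * (fromℕ G * x) ≡⟨ cong (fromℕ F * y *_) (fromℕ*1/ℕ G {{(n ∸ k) !≢0}}) ⟩
    fromℕ F * y * 1ℚ       ≡⟨ ℚP.*-identityʳ _ ⟩
    fromℕ F * y            ∎
    where
    x y : ℚ
    x = (n ∸ k) !⁻¹
    y = n !⁻¹
    F G : ℕ
    F = n ↓ k
    G = (n ∸ k) !
    rearrange : ∀ x y f g → x * (f * g * y) ≡ f * y * (g * x)
    rearrange = solve-∀ ℚ-ring

  egf-⋆ : ∀ g e → egf (g ⋆ e) ≗ (fromℕ ∘ g) ⊛ egf e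
  egf-⋆ g e n = begin
    egf (g ⋆ e) n                                                ≡⟨ egf≡*!⁻¹ (g ⋆ e) n ⟩
    fromℕ ((g ⋆ e) n) * n !⁻¹                                    ≡⟨ cong (_* n !⁻¹) (fromℕ-sumℕ n _) ⟩
    sumTo n (λ k → fromℕ (g k ℕ.* n ↓ k ℕ.* e (n ∸ k))) * n !⁻¹   ≡⟨ sumTo-*ʳ n (n !⁻¹) _ ⟨
    sumTo n (λ k → fromℕ (g k ℕ.* n ↓ k ℕ.* e (n ∸ k)) * n !⁻¹)   ≡⟨ sumTo-cong n term ⟩
    ((fromℕ ∘ g) ⊛ egf e) n                                      ∎
    where
    rearrange : ∀ a b c y → a * b * c * y ≡ a * (c * (b * y))
    rearrange = solve-∀ ℚ-ring
    term : ∀ k → k ≤ n → fromℕ (g k ℕ.* n ↓ k ℕ.* e (n ∸ k)) * n !⁻¹ ≡ fromℕ (g k) * egf e (n ∸ k)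
    term k k≤n = begin
      fromℕ (g k ℕ.* n ↓ k ℕ.* e (n ∸ k)) * n !⁻¹
        ≡⟨ cong (_* n !⁻¹) (trans (fromℕ-* (g k ℕ.* n ↓ k) (e (n ∸ k)))
                                  (cong (_* fromℕ (e (n ∸ k))) (fromℕ-* (g k) (n ↓ k)))) ⟩
      fromℕ (g k) * fromℕ (n ↓ k) * fromℕ (e (n ∸ k)) * n !⁻¹
        ≡⟨ rearrange (fromℕ (g k)) (fromℕ (n ↓ k)) (fromℕ (e (n ∸ k))) (n !⁻¹) ⟩
      fromℕ (g k) * (fromℕ (e (n ∸ k)) * (fromℕ (n ↓ k) * n !⁻¹))
        ≡⟨ cong (λ t → fromℕ (g k) * (fromℕ (e (n ∸ k)) * t)) (!⁻¹-↓ k≤n) ⟨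
      fromℕ (g k) * (fromℕ (e (n ∸ k)) * (n ∸ k) !⁻¹)
        ≡⟨ cong (fromℕ (g k) *_) (egf≡*!⁻¹ e (n ∸ k)) ⟨
      fromℕ (g k) * egf e (n ∸ k)
        ∎

  egf-+ : ∀ e e′ → egf (λ n → e n ℕ.+ e′ n) ≗ egf e ⊕ egf e′
  egf-+ e e′ n = begin
    egf (λ n → e n ℕ.+ e′ n) n                   ≡⟨ egf≡*!⁻¹ (λ n → e n ℕ.+ e′ n) n ⟩
    fromℕ (e n ℕ.+ e′ n) * n !⁻¹                 ≡⟨ cong (_* n !⁻¹) (fromℕ-+ (e n) (e′ n)) ⟩
    (fromℕ (e n) ℚ.+ fromℕ (e′ n)) * n !⁻¹       ≡⟨ ℚP.*-distribʳ-+ (n !⁻¹) (fromℕ (e n)) (fromℕ (e′ n)) ⟩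
    fromℕ (e n) * n !⁻¹ ℚ.+ fromℕ (e′ n) * n !⁻¹ ≡⟨ cong₂ ℚ._+_ (egf≡*!⁻¹ e n) (egf≡*!⁻¹ e′ n) ⟨
    egf e n ℚ.+ egf e′ n                         ∎

  egf-* : ∀ c e → egf (λ n → c ℕ.* e n) ≗ fromℕ c · egf e
  egf-* c e n = begin
    egf (λ n → c ℕ.* e n) n            ≡⟨ egf≡*!⁻¹ (λ n → c ℕ.* e n) n ⟩
    fromℕ (c ℕ.* e n) * n !⁻¹          ≡⟨ cong (_* n !⁻¹) (fromℕ-* c (e n)) ⟩
    fromℕ c * fromℕ (e n) * n !⁻¹      ≡⟨ ℚP.*-assoc (fromℕ c) (fromℕ (e n)) (n !⁻¹) ⟩
    fromℕ c * (fromℕ (e n) * n !⁻¹)    ≡⟨ cong (fromℕ c *_) (egf≡*!⁻¹ e n) ⟨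
    fromℕ c * egf e n                  ∎

egf-cong : ∀ {e e′} → e ≗ e′ → egf e ≗ egf e′
egf-cong e≗e′ n = cong (λ x → egf (λ _ → x) n) (e≗e′ n)

-- Counting by block sizes

open import Data.Nat using (_+_; _*_)

𝟙[_] : Bool → ℕ
𝟙[ true  ] = 1
𝟙[ false ] = 0

sumOver : {A : Set} → List A → (A → ℕ) → ℕ
sumOver []       f = 0
sumOver (x ∷ xs) f = f x + sumOver xs f

syntax sumOver xs (λ x → e) = ∑[ x ∈ xs ] e

private variable
  A B : Set

sumOver-cong : ∀ {f g : A → ℕ} → f ≗ g → ∀ xs → sumOver xs f ≡ sumOver xs g
sumOver-cong f≗g []       = refl
sumOver-cong f≗g (x ∷ xs) = cong₂ _+_ (f≗g x) (sumOver-cong f≗g xs)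

sumOver-++ : ∀ (f : A → ℕ) xs ys → sumOver (xs ++ ys) f ≡ sumOver xs f + sumOver ys f
sumOver-++ f []       ys = refl
sumOver-++ f (x ∷ xs) ys = trans (cong (f x +_) (sumOver-++ f xs ys)) (sym (ℕP.+-assoc (f x) _ _))

sumOver-concatMap : ∀ (f : B → ℕ) (g : A → List B) xs →
                    sumOver (concatMap g xs) f ≡ ∑[ x ∈ xs ] sumOver (g x) f
sumOver-concatMap f g []       = refl
sumOver-concatMap f g (x ∷ xs) = trans (sumOver-++ f (g x) (concatMap g xs)) (cong (sumOver (g x) f +_) (sumOver-concatMap f g xs))

sumOver-map : ∀ (f : B → ℕ) (g : A → B) xs → sumOver (map g xs) f ≡ sumOver xs (f ∘ g)
sumOver-map f g []       = refl
sumOver-map f g (x ∷ xs) = cong (f (g x) +_) (sumOver-map f g xs)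

sumOver-+ : ∀ (f g : A → ℕ) xs → ∑[ x ∈ xs ] (f x + g x) ≡ sumOver xs f + sumOver xs g
sumOver-+ f g []       = refl
sumOver-+ f g (x ∷ xs) = trans (cong (f x + g x +_) (sumOver-+ f g xs)) (ℕ+.interchange (f x) (g x) _ _)

sumOver-*ˡ : ∀ c (f : A → ℕ) xs → ∑[ x ∈ xs ] (c * f x) ≡ c * sumOver xs f
sumOver-*ˡ c f []       = sym (ℕP.*-zeroʳ c)
sumOver-*ˡ c f (x ∷ xs) = trans (cong (c * f x +_) (sumOver-*ˡ c f xs)) (sym (ℕP.*-distribˡ-+ c (f x) _))

length-filter : ∀ {A : Set} {P : Pred A 0ℓ} (P? : Decidable P) xs →
                length (filter P? xs) ≡ ∑[ x ∈ xs ] 𝟙[ does (P? x) ]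
length-filter P? []       = refl
length-filter P? (x ∷ xs) with does (P? x)
... | true  = cong suc (length-filter P? xs)
... | false = length-filter P? xs

does-⇔ : ∀ {P : Set} (P? : Dec P) {b} → P ⇔ T b → does P? ≡ b
does-⇔ (yes p)  {true}  _   = refl
does-⇔ (yes p)  {false} P⇔b = contradiction (Equivalence.to P⇔b p) λ ()
does-⇔ (no ¬p)  {true}  P⇔b = contradiction (Equivalence.from P⇔b _) ¬p
does-⇔ (no ¬p)  {false} _   = refl

sumOver-comps-firstPart : ∀ N (g : List ℕ → ℕ) →
  ∑[ c ∈ comps (suc N) ] g c ≡ sumℕ N (λ s → ∑[ c ∈ comps (N ∸ s) ] g (suc s ∷ c))
sumOver-comps-firstPart zero    g = refl
sumOver-comps-firstPart (suc N) g = begin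
  ∑[ c ∈ comps (suc (suc N)) ] g c
    ≡⟨ trans (sumOver-concatMap g _ (comps (suc N)))
             (sumOver-cong {g = g′} (λ { []       → ℕP.+-identityʳ (g (1 ∷ []))
                                       ; (p ∷ ps) → cong (g (suc p ∷ ps) +_) (ℕP.+-identityʳ _) })
                                    (comps (suc N))) ⟩
  ∑[ c ∈ comps (suc N) ] g′ c
    ≡⟨ sumOver-comps-firstPart N g′ ⟩
  sumℕ N (λ s → ∑[ c ∈ comps (N ∸ s) ] (g (suc (suc s) ∷ c) + g (1 ∷ suc s ∷ c)))
    ≡⟨ trans (sumℕ-cong N (λ s _ → sumOver-+ _ _ (comps (N ∸ s)))) (sumℕ-+ N _ _) ⟩
  firstPart≥2 + sumℕ N (λ s → ∑[ c ∈ comps (N ∸ s) ] g (1 ∷ suc s ∷ c))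
    ≡⟨ cong (firstPart≥2 +_) (sumOver-comps-firstPart N (g ∘ (1 ∷_))) ⟨
  firstPart≥2 + ∑[ c ∈ comps (suc N) ] g (1 ∷ c)
    ≡⟨ ℕP.+-comm firstPart≥2 _ ⟩
  ∑[ c ∈ comps (suc N) ] g (1 ∷ c) + firstPart≥2
    ≡⟨ sumℕ-suc N (λ s → ∑[ c ∈ comps (suc N ∸ s) ] g (suc s ∷ c)) ⟨
  sumℕ (suc N) (λ s → ∑[ c ∈ comps (suc N ∸ s) ] g (suc s ∷ c))
    ∎
  where
  open ≡-Reasoning
  g′ : List ℕ → ℕ
  g′ []       = g (1 ∷ [])
  g′ (p ∷ ps) = g (suc p ∷ ps) + g (1 ∷ p ∷ ps)
  firstPart≥2 : ℕ
  firstPart≥2 = sumℕ N (λ s → ∑[ c ∈ comps (N ∸ s) ] g (suc (suc s) ∷ c))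

-- draws k p q g sums g (special labels drawn) (special labels left) (ordinary labels left)
-- over the ways to draw k labels in order, without replacement, from p special and q
-- ordinary ones.
draws : ℕ → ℕ → ℕ → (ℕ → ℕ → ℕ → ℕ) → ℕ
draws zero    p q g = g 0 p q
draws (suc k) p q g = p * draws k (p ∸ 1) q (g ∘ suc) + q * draws k p (q ∸ 1) g

draws-≡0 : ∀ k p q g → (∀ j p q → g j p q ≡ 0) → draws k p q g ≡ 0
draws-≡0 zero    p q g g≡0 = g≡0 0 p q
draws-≡0 (suc k) p q g g≡0 = cong₂ _+_
  (trans (cong (p *_) (draws-≡0 k (p ∸ 1) q (g ∘ suc) (g≡0 ∘ suc))) (ℕP.*-zeroʳ p))
  (trans (cong (q *_) (draws-≡0 k p (q ∸ 1) g g≡0)) (ℕP.*-zeroʳ q))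

draws-noSpecial : ∀ k p q g → (∀ j p q → g (suc j) p q ≡ 0) → draws k p q g ≡ q ↓ k * g 0 p (q ∸ k)
draws-noSpecial zero    p q g _   = sym (ℕP.+-identityʳ (g 0 p q))
draws-noSpecial (suc k) p q g g≡0 = begin
  p * draws k (p ∸ 1) q (g ∘ suc) + q * draws k p (q ∸ 1) g
    ≡⟨ cong₂ _+_ (trans (cong (p *_) (draws-≡0 k (p ∸ 1) q (g ∘ suc) g≡0)) (ℕP.*-zeroʳ p))
                 (cong (q *_) (draws-noSpecial k p (q ∸ 1) g g≡0)) ⟩
  q * ((q ∸ 1) ↓ k * g 0 p (q ∸ 1 ∸ k))
    ≡⟨ sym (ℕP.*-assoc q _ _) ⟩
  q ↓ suc k * g 0 p (q ∸ 1 ∸ k)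
    ≡⟨ cong (λ t → q ↓ suc k * g 0 p t) (ℕP.∸-+-assoc q 1 k) ⟩
  q ↓ suc k * g 0 p (q ∸ suc k)
    ∎
  where open ≡-Reasoning

draws-atMostOneSpecial : ∀ k p q g → (∀ j p q → g (suc (suc j)) p q ≡ 0) →
  draws (suc k) p q g ≡ q ↓ suc k * g 0 p (q ∸ suc k) + suc k * p * q ↓ k * g 1 (p ∸ 1) (q ∸ k)
draws-atMostOneSpecial zero p q g _ = arrange p q (g 0 p (q ∸ 1)) (g 1 (p ∸ 1) q)
  where
  arrange : ∀ p q a b → p * b + q * a ≡ q * 1 * a + 1 * p * 1 * b
  arrange = ℕSolver.solve-∀
draws-atMostOneSpecial (suc k) p q g g≡0 = begin
  p * draws (suc k) (p ∸ 1) q (g ∘ suc) + q * draws (suc k) p (q ∸ 1) g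
    ≡⟨ cong₂ _+_ (cong (p *_) (draws-noSpecial (suc k) (p ∸ 1) q (g ∘ suc) g≡0))
                 (cong (q *_) (draws-atMostOneSpecial k p (q ∸ 1) g g≡0)) ⟩
  p * (q ↓ suc k * g 1 (p ∸ 1) (q ∸ suc k))
    + q * ((q ∸ 1) ↓ suc k * g 0 p (q ∸ 1 ∸ suc k) + suc k * p * (q ∸ 1) ↓ k * g 1 (p ∸ 1) (q ∸ 1 ∸ k))
    ≡⟨ cong₂ (λ a b → p * (q ↓ suc k * g 1 (p ∸ 1) (q ∸ suc k))
                        + q * ((q ∸ 1) ↓ suc k * g 0 p a + suc k * p * (q ∸ 1) ↓ k * g 1 (p ∸ 1) b))
             (ℕP.∸-+-assoc q 1 (suc k)) (ℕP.∸-+-assoc q 1 k) ⟩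
  p * (q ↓ suc k * g 1 (p ∸ 1) (q ∸ suc k))
    + q * ((q ∸ 1) ↓ suc k * g 0 p (q ∸ suc (suc k)) + suc k * p * (q ∸ 1) ↓ k * g 1 (p ∸ 1) (q ∸ suc k))
    ≡⟨ arrange p q k ((q ∸ 1) ↓ k) ((q ∸ 1) ↓ suc k) (g 0 p (q ∸ suc (suc k))) (g 1 (p ∸ 1) (q ∸ suc k)) ⟩
  q ↓ suc (suc k) * g 0 p (q ∸ suc (suc k)) + suc (suc k) * p * q ↓ suc k * g 1 (p ∸ 1) (q ∸ suc k)
    ∎
  where
  open ≡-Reasoning
  arrange : ∀ p q k F F′ a b → p * ((q * F) * b) + q * (F′ * a + suc k * p * F * b)
                             ≡ q * F′ * a + suc (suc k) * p * (q * F) * b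
  arrange = ℕSolver.solve-∀

↓-*-cong : ∀ q k {a b} → (k ≤ q → a ≡ b) → q ↓ k * a ≡ q ↓ k * b
↓-*-cong q k a≡b with k ℕP.≤? q
... | yes k≤q = cong (q ↓ k *_) (a≡b k≤q)
... | no  k≰q rewrite <⇒↓≡0 (ℕP.≰⇒> k≰q) = refl

*-congˡ-positive : ∀ p {a b} → (1 ≤ p → a ≡ b) → p * a ≡ p * b
*-congˡ-positive zero    _   = refl
*-congˡ-positive (suc p) a≡b = cong (suc p *_) (a≡b (s≤s z≤n))

δ : ℕ → ℕ → ℕ
δ p q = 𝟙[ p + q ≡ᵇ 0 ]

χ : (ℕ → Bool) → ℕ → ℕ
χ S k = 𝟙[ S k ]

χ′ : (ℕ → Bool) → ℕ → ℕ
χ′ S k = 𝟙[ S (suc k) ] * suc k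

module _ (S : ℕ → Bool) where

  -- fillings cs p q counts the ways to fill blocks of sizes cs with p special and q
  -- ordinary labels, using every label once and at most one special label per block.
  fillings : List ℕ → ℕ → ℕ → ℕ
  fillings []       p q = δ p q
  fillings (c ∷ cs) p q = χ S c * draws c p q (λ j p′ q′ → 𝟙[ j ≤ᵇ 1 ] * fillings cs p′ q′)

  dopCount : ℕ → ℕ → ℕ
  dopCount p q = ∑[ c ∈ comps (q + p) ] fillings c p q

  fillings-suc : ∀ s cs p q → fillings (suc s ∷ cs) p q
    ≡ χ S (suc s) * (q ↓ suc s * fillings cs p (q ∸ suc s)) + χ′ S s * (p * (q ↓ s * fillings cs (p ∸ 1) (q ∸ s)))
  fillings-suc s cs p q = begin
    χ S (suc s) * draws (suc s) p q g
      ≡⟨ cong (χ S (suc s) *_) (draws-atMostOneSpecial s p q g (λ _ _ _ → refl)) ⟩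
    χ S (suc s) * (q ↓ suc s * (1 * F) + suc s * p * q ↓ s * (1 * F′))
      ≡⟨ arrange (χ S (suc s)) (q ↓ suc s) F (suc s) p (q ↓ s) F′ ⟩
    χ S (suc s) * (q ↓ suc s * F) + χ′ S s * (p * (q ↓ s * F′))
      ∎
    where
    open ≡-Reasoning
    g : ℕ → ℕ → ℕ → ℕ
    g j p′ q′ = 𝟙[ j ≤ᵇ 1 ] * fillings cs p′ q′
    F F′ : ℕ
    F = fillings cs p (q ∸ suc s)
    F′ = fillings cs (p ∸ 1) (q ∸ s)
    arrange : ∀ a f₁ x k p f₀ y → a * (f₁ * (1 * x) + k * p * f₀ * (1 * y)) ≡ a * (f₁ * x) + a * k * (p * (f₀ * y))
    arrange = ℕSolver.solve-∀

  sumOver-fillings-firstPart : ∀ {N p q} → q + p ≡ suc N → ∀ s → ∑[ c ∈ comps (N ∸ s) ] fillings (suc s ∷ c) p q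
    ≡ χ S (suc s) * (q ↓ suc s * dopCount p (q ∸ suc s)) + χ′ S s * (p * (q ↓ s * dopCount (p ∸ 1) (q ∸ s)))
  sumOver-fillings-firstPart {N} {p} {q} q+p≡1+N s = begin
    ∑[ c ∈ cs ] fillings (suc s ∷ c) p q
      ≡⟨ sumOver-cong (λ c → fillings-suc s c p q) cs ⟩
    ∑[ c ∈ cs ] (a * (q ↓ suc s * X c) + b * (p * (q ↓ s * Y c)))
      ≡⟨ sumOver-+ _ _ cs ⟩
    ∑[ c ∈ cs ] (a * (q ↓ suc s * X c)) + ∑[ c ∈ cs ] (b * (p * (q ↓ s * Y c)))
      ≡⟨ cong₂ _+_ (trans (sumOver-*ˡ a _ cs) (cong (a *_) (sumOver-*ˡ (q ↓ suc s) X cs)))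
                   (trans (sumOver-*ˡ b _ cs)
                          (cong (b *_) (trans (sumOver-*ˡ p _ cs) (cong (p *_) (sumOver-*ˡ (q ↓ s) Y cs))))) ⟩
    a * (q ↓ suc s * sumOver cs X) + b * (p * (q ↓ s * sumOver cs Y))
      ≡⟨ cong₂ (λ x y → a * x + b * y) noSpecialFirst oneSpecialFirst ⟩
    a * (q ↓ suc s * dopCount p (q ∸ suc s)) + b * (p * (q ↓ s * dopCount (p ∸ 1) (q ∸ s)))
      ∎
    where
    open ≡-Reasoning
    cs : List (List ℕ)
    cs = comps (N ∸ s)
    a b : ℕ
    a = χ S (suc s)
    b = χ′ S s
    X Y : List ℕ → ℕ
    X c = fillings c p (q ∸ suc s)
    Y c = fillings c (p ∸ 1) (q ∸ s)
    noSpecialFirst : q ↓ suc s * sumOver cs X ≡ q ↓ suc s * dopCount p (q ∸ suc s)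
    noSpecialFirst = ↓-*-cong q (suc s) λ 1+s≤q → cong (λ L → sumOver (comps L) X)
      (trans (cong (_∸ suc s) (sym q+p≡1+N)) (ℕP.+-∸-comm p 1+s≤q))
    oneSpecialFirst : p * (q ↓ s * sumOver cs Y) ≡ p * (q ↓ s * dopCount (p ∸ 1) (q ∸ s))
    oneSpecialFirst = *-congˡ-positive p λ 1≤p → ↓-*-cong q s λ s≤q → cong (λ L → sumOver (comps L) Y)
      (trans (cong (_∸ s) (trans (cong (_∸ 1) (sym q+p≡1+N)) (ℕP.+-∸-assoc q 1≤p))) (ℕP.+-∸-comm (p ∸ 1) s≤q))

  module _ (S0 : S 0 ≡ false) where

    dopCount-rec⁺ : ∀ {N p q} → q + p ≡ suc N →
      dopCount p q ≡ (χ S ⋆ dopCount p) q + p * (χ′ S ⋆ dopCount (p ∸ 1)) q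
    dopCount-rec⁺ {N} {p} {q} q+p≡1+N = begin
      ∑[ c ∈ comps (q + p) ] fillings c p q
        ≡⟨ cong (λ L → ∑[ c ∈ comps L ] fillings c p q) q+p≡1+N ⟩
      ∑[ c ∈ comps (suc N) ] fillings c p q
        ≡⟨ sumOver-comps-firstPart N (λ c → fillings c p q) ⟩
      sumℕ N (λ s → ∑[ c ∈ comps (N ∸ s) ] fillings (suc s ∷ c) p q)
        ≡⟨ sumℕ-cong N (λ s _ → trans (sumOver-fillings-firstPart {N} {p} {q} q+p≡1+N s)
                                      (arrange (χ S (suc s)) (q ↓ suc s) _ (χ′ S s) p (q ↓ s) _)) ⟩
      sumℕ N (λ s → G (suc s) + p * H s)
        ≡⟨ trans (sumℕ-+ N (G ∘ suc) _) (cong (sumℕ N (G ∘ suc) +_) (sumℕ-*ˡ N p H)) ⟩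
      sumℕ N (G ∘ suc) + p * sumℕ N H
        ≡⟨ cong₂ _+_ noSpecialFirst oneSpecialFirst ⟩
      (χ S ⋆ dopCount p) q + p * (χ′ S ⋆ dopCount (p ∸ 1)) q
        ∎
      where
      open ≡-Reasoning
      G H : ℕ → ℕ
      G k = χ S k * q ↓ k * dopCount p (q ∸ k)
      H k = χ′ S k * q ↓ k * dopCount (p ∸ 1) (q ∸ k)
      arrange : ∀ a f₁ x b p f₀ y → a * (f₁ * x) + b * (p * (f₀ * y)) ≡ a * f₁ * x + p * (b * f₀ * y)
      arrange = ℕSolver.solve-∀
      noSpecialFirst : sumℕ N (G ∘ suc) ≡ (χ S ⋆ dopCount p) q
      noSpecialFirst = sym (begin
        (χ S ⋆ dopCount p) q     ≡⟨ ⋆-extend (χ S) (dopCount p) (subst (q ≤_) q+p≡1+N (ℕP.m≤m+n q p)) ⟩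
        sumℕ (suc N) G           ≡⟨ sumℕ-suc N G ⟩
        G 0 + sumℕ N (G ∘ suc)   ≡⟨ cong (λ b → 𝟙[ b ] * 1 * dopCount p (q ∸ 0) + sumℕ N (G ∘ suc)) S0 ⟩
        sumℕ N (G ∘ suc)         ∎)
      oneSpecialFirst : p * sumℕ N H ≡ p * (χ′ S ⋆ dopCount (p ∸ 1)) q
      oneSpecialFirst = *-congˡ-positive p λ 1≤p → sym (⋆-extend (χ′ S) (dopCount (p ∸ 1))
        (ℕP.≤-pred (subst₂ _≤_ (ℕP.+-comm q 1) q+p≡1+N (ℕP.+-monoʳ-≤ q 1≤p))))

    dopCount-rec : ∀ p q → dopCount p q ≡ δ p q + (χ S ⋆ dopCount p) q + p * (χ′ S ⋆ dopCount (p ∸ 1)) q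
    dopCount-rec zero    zero    rewrite S0 = refl
    dopCount-rec zero    (suc q) = dopCount-rec⁺ {p = 0} {suc q} (cong suc (ℕP.+-identityʳ q))
    dopCount-rec (suc p) q       = dopCount-rec⁺ {p = suc p} {q} (ℕP.+-suc q p)

-- Enumerating the candidates

𝟙-∧ : ∀ a b → 𝟙[ a ∧ b ] ≡ 𝟙[ a ] * 𝟙[ b ]
𝟙-∧ true  b = sym (ℕP.+-identityʳ 𝟙[ b ])
𝟙-∧ false b = refl

sumOver-tabulate : ∀ {A : Set} {n} (f : A → ℕ) (g : Fin n → A) → ∑[ x ∈ tabulate g ] f x ≡ sum (f ∘ g)
sumOver-tabulate {n = zero}  f g = refl
sumOver-tabulate {n = suc n} f g = cong (f (g Fin.zero) +_) (sumOver-tabulate f (g ∘ Fin.suc))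

sum-swapAt : ∀ {n} (f g : Fin n → ℕ) i → (∀ j → j ≢ i → f j ≡ g j) → sum f + g i ≡ sum g + f i
sum-swapAt {suc n} f g i f≡g = begin
  sum f + g i                         ≡⟨ cong (_+ g i) (sum-remove {i = i} f) ⟩
  f i + sum (f ∘ punchIn i) + g i     ≡⟨ cong (λ t → f i + t + g i) (sum-cong-≗ λ j → f≡g (punchIn i j) (punchInᵢ≢i i j)) ⟩
  f i + sum (g ∘ punchIn i) + g i     ≡⟨ ℕ+.xy∙z≈zy∙x (f i) _ (g i) ⟩
  g i + sum (g ∘ punchIn i) + f i     ≡⟨ cong (_+ f i) (sum-remove {i = i} g) ⟨
  sum g + f i                         ∎
  where open ≡-Reasoning

sumOver-𝟙-∧ : ∀ {A : Set} a (f : A → Bool) xs → ∑[ x ∈ xs ] 𝟙[ a ∧ f x ] ≡ 𝟙[ a ] * ∑[ x ∈ xs ] 𝟙[ f x ]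
sumOver-𝟙-∧ a f xs = trans (sumOver-cong (λ x → 𝟙-∧ a (f x)) xs) (sumOver-*ˡ 𝟙[ a ] (λ x → 𝟙[ f x ]) xs)

sumOver-words-length : ∀ {m} k (f : ℕ → List (Fin m) → ℕ) →
                       ∑[ w ∈ words m k ] f (length w) w ≡ ∑[ w ∈ words m k ] f k w
sumOver-words-length         zero    f = refl
sumOver-words-length {m = m} (suc k) f = begin
  sumOver (concatMap (λ i → map (i ∷_) (words m k)) (allFin m)) (λ w → f (length w) w)
    ≡⟨ sumOver-concatMap _ (λ i → map (i ∷_) (words m k)) (allFin m) ⟩
  ∑[ i ∈ allFin m ] sumOver (map (i ∷_) (words m k)) (λ w → f (length w) w)
    ≡⟨ sumOver-cong (λ i → trans (sumOver-map _ (i ∷_) (words m k))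
                          (trans (sumOver-words-length k (λ l w → f (suc l) (i ∷ w)))
                                 (sym (sumOver-map (f (suc k)) (i ∷_) (words m k))))) (allFin m) ⟩
  ∑[ i ∈ allFin m ] sumOver (map (i ∷_) (words m k)) (f (suc k))
    ≡⟨ sumOver-concatMap (f (suc k)) (λ i → map (i ∷_) (words m k)) (allFin m) ⟨
  sumOver (concatMap (λ i → map (i ∷_) (words m k)) (allFin m)) (f (suc k))
    ∎
  where open ≡-Reasoning

count : ∀ {n} → (Fin n → Bool) → ℕ
count X = sum (λ i → 𝟙[ X i ])

count≡0⇔ : ∀ {n} (X : Fin n → Bool) → count X ≡ 0 ⇔ (∀ i → ¬ T (X i))
count≡0⇔ X = mk⇔ (count≡0⇒ X) (count≡0⇐ X)
  where
  count≡0⇒ : ∀ {n} (X : Fin n → Bool) → count X ≡ 0 → ∀ i → ¬ T (X i)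
  count≡0⇒ X c≡0 Fin.zero    with X Fin.zero
  ... | false = λ ()
  count≡0⇒ X c≡0 (Fin.suc i) = count≡0⇒ (X ∘ Fin.suc) (ℕP.m+n≡0⇒n≡0 𝟙[ X Fin.zero ] c≡0) i
  count≡0⇐ : ∀ {n} (X : Fin n → Bool) → (∀ i → ¬ T (X i)) → count X ≡ 0
  count≡0⇐ {zero}  X _  = refl
  count≡0⇐ {suc n} X ¬X with X Fin.zero in X₀
  ... | true  = ⊥-elim (¬X Fin.zero (subst T (sym X₀) _))
  ... | false = count≡0⇐ (X ∘ Fin.suc) (¬X ∘ Fin.suc)

count-toℕ< : ∀ m r → count {m} (λ i → does (toℕ i <? r)) ≡ m ⊓ r
count-toℕ< zero    r       = refl
count-toℕ< (suc m) zero    = trans (count-toℕ< m 0) (ℕP.⊓-zeroʳ m)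
count-toℕ< (suc m) (suc r) = cong suc (count-toℕ< m r)

count-toℕ≮ : ∀ m r → count {m} (λ i → not (does (toℕ i <? r))) ≡ m ∸ r
count-toℕ≮ zero    r       = sym (ℕP.0∸n≡0 r)
count-toℕ≮ (suc m) zero    = cong suc (count-toℕ≮ m 0)
count-toℕ≮ (suc m) (suc r) = count-toℕ≮ m r

module _ (r m : ℕ) where

  Pool : Set
  Pool = Fin m → Bool

  special : Fin m → Bool
  special i = does (toℕ i <? r)

  remove : Fin m → Pool → Pool
  remove i U j = if does (i ≟ j) then false else U j

  remove-self : ∀ i U → remove i U i ≡ false
  remove-self i U with i ≟ i
  ... | yes _   = refl
  ... | no  i≢i = contradiction refl i≢i

  remove-other : ∀ i j U → i ≢ j → remove i U j ≡ U j
  remove-other i j U i≢j with i ≟ j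
  ... | yes i≡j = contradiction i≡j i≢j
  ... | no  _   = refl

  #special #ordinary : Pool → ℕ
  #special  U = count (λ i → U i ∧ special i)
  #ordinary U = count (λ i → U i ∧ not (special i))

  count-remove : ∀ U i (X : Fin m → Bool) → U i ≡ true →
    count (λ j → remove i U j ∧ X j) ≡ count (λ j → U j ∧ X j) ∸ 𝟙[ X i ]
  count-remove U i X Ui = trans (sym (ℕP.m+n∸n≡m _ 𝟙[ X i ])) (cong (_∸ 𝟙[ X i ]) (begin
    count (λ j → remove i U j ∧ X j) + 𝟙[ X i ]
      ≡⟨ cong (λ b → count (λ j → remove i U j ∧ X j) + 𝟙[ b ∧ X i ]) (sym Ui) ⟩
    count (λ j → remove i U j ∧ X j) + 𝟙[ U i ∧ X i ]
      ≡⟨ sum-swapAt _ _ i (λ j j≢i → cong (λ b → 𝟙[ b ∧ X j ]) (remove-other i j U (j≢i ∘ sym))) ⟩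
    count (λ j → U j ∧ X j) + 𝟙[ remove i U i ∧ X i ]
      ≡⟨ cong (λ b → count (λ j → U j ∧ X j) + 𝟙[ b ∧ X i ]) (remove-self i U) ⟩
    count (λ j → U j ∧ X j) + 0
      ≡⟨ ℕP.+-identityʳ _ ⟩
    count (λ j → U j ∧ X j)
      ∎))
    where open ≡-Reasoning

  drawFirst : ∀ U i k g →
    𝟙[ U i ] * draws k (#special (remove i U)) (#ordinary (remove i U)) (g ∘ (𝟙[ special i ] +_))
      ≡ 𝟙[ U i ∧ special i ] * draws k (#special U ∸ 1) (#ordinary U) (g ∘ suc)
        + 𝟙[ U i ∧ not (special i) ] * draws k (#special U) (#ordinary U ∸ 1) g
  drawFirst U i k g with U i in Ui | special i in si
  ... | false | _     = refl
  ... | true  | true  = trans (cong₂ (λ p q → 1 * draws k p q (g ∘ suc)) sp ord) (sym (ℕP.+-identityʳ _))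
    where
    sp : #special (remove i U) ≡ #special U ∸ 1
    sp = trans (count-remove U i special Ui) (cong (λ b → #special U ∸ 𝟙[ b ]) si)
    ord : #ordinary (remove i U) ≡ #ordinary U
    ord = trans (count-remove U i (not ∘ special) Ui) (cong (λ b → #ordinary U ∸ 𝟙[ not b ]) si)
  ... | true  | false = cong₂ (λ p q → 1 * draws k p q g) sp ord
    where
    sp : #special (remove i U) ≡ #special U
    sp = trans (count-remove U i special Ui) (cong (λ b → #special U ∸ 𝟙[ b ]) si)
    ord : #ordinary (remove i U) ≡ #ordinary U ∸ 1
    ord = trans (count-remove U i (not ∘ special) Ui) (cong (λ b → #ordinary U ∸ 𝟙[ not b ]) si)

  drawable : Pool → List (Fin m) → Bool
  drawable U []      = true
  drawable U (i ∷ w) = U i ∧ drawable (remove i U) w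

  infixl 5 _∖_
  _∖_ : Pool → List (Fin m) → Pool
  U ∖ []      = U
  U ∖ (i ∷ w) = remove i U ∖ w

  specials-∷ : ∀ i w → specials r (i ∷ w) ≡ 𝟙[ special i ] + specials r w
  specials-∷ i w with special i
  ... | true  = refl
  ... | false = refl

  sumOver-words : ∀ k U g →
    ∑[ w ∈ words m k ] (𝟙[ drawable U w ] * g (specials r w) (#special (U ∖ w)) (#ordinary (U ∖ w)))
      ≡ draws k (#special U) (#ordinary U) g
  sumOver-words zero    U g = trans (ℕP.+-identityʳ _) (ℕP.*-identityˡ _)
  sumOver-words (suc k) U g = begin
    sumOver (concatMap (λ i → map (i ∷_) (words m k)) (allFin m)) (F U g)
      ≡⟨ sumOver-concatMap (F U g) (λ i → map (i ∷_) (words m k)) (allFin m) ⟩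
    ∑[ i ∈ allFin m ] sumOver (map (i ∷_) (words m k)) (F U g)
      ≡⟨ sumOver-tabulate (λ i → sumOver (map (i ∷_) (words m k)) (F U g)) (λ i → i) ⟩
    sum (λ i → sumOver (map (i ∷_) (words m k)) (F U g))
      ≡⟨ sum-cong-≗ (λ i → trans (firstLetter i) (drawFirst U i k g)) ⟩
    sum (λ i → 𝟙[ U i ∧ special i ] * afterSpecial + 𝟙[ U i ∧ not (special i) ] * afterOrdinary)
      ≡⟨ ∑-distrib-+ (λ i → 𝟙[ U i ∧ special i ] * afterSpecial) (λ i → 𝟙[ U i ∧ not (special i) ] * afterOrdinary) ⟩
    sum (λ i → 𝟙[ U i ∧ special i ] * afterSpecial) + sum (λ i → 𝟙[ U i ∧ not (special i) ] * afterOrdinary)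
      ≡⟨ cong₂ _+_ (*-distribʳ-sum afterSpecial (λ i → 𝟙[ U i ∧ special i ]))
                   (*-distribʳ-sum afterOrdinary (λ i → 𝟙[ U i ∧ not (special i) ])) ⟨
    #special U * afterSpecial + #ordinary U * afterOrdinary
      ∎
    where
    open ≡-Reasoning
    F : Pool → (ℕ → ℕ → ℕ → ℕ) → List (Fin m) → ℕ
    F U g w = 𝟙[ drawable U w ] * g (specials r w) (#special (U ∖ w)) (#ordinary (U ∖ w))
    afterSpecial afterOrdinary : ℕ
    afterSpecial = draws k (#special U ∸ 1) (#ordinary U) (g ∘ suc)
    afterOrdinary = draws k (#special U) (#ordinary U ∸ 1) g
    firstLetter : ∀ i → sumOver (map (i ∷_) (words m k)) (F U g)
      ≡ 𝟙[ U i ] * draws k (#special (remove i U)) (#ordinary (remove i U)) (g ∘ (𝟙[ special i ] +_))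
    firstLetter i = begin
      sumOver (map (i ∷_) (words m k)) (F U g)
        ≡⟨ sumOver-map (F U g) (i ∷_) (words m k) ⟩
      ∑[ w ∈ words m k ] F U g (i ∷ w)
        ≡⟨ sumOver-cong (λ w → trans (cong₂ _*_ (𝟙-∧ (U i) _) (cong (λ s → g s (#special (remove i U ∖ w))
                                                                                (#ordinary (remove i U ∖ w)))
                                                                      (specials-∷ i w)))
                                     (ℕP.*-assoc 𝟙[ U i ] _ _)) (words m k) ⟩
      ∑[ w ∈ words m k ] (𝟙[ U i ] * F (remove i U) (g ∘ (𝟙[ special i ] +_)) w)
        ≡⟨ sumOver-*ˡ 𝟙[ U i ] _ (words m k) ⟩
      𝟙[ U i ] * ∑[ w ∈ words m k ] F (remove i U) (g ∘ (𝟙[ special i ] +_)) w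
        ≡⟨ cong (𝟙[ U i ] *_) (sumOver-words k (remove i U) (g ∘ (𝟙[ special i ] +_))) ⟩
      𝟙[ U i ] * draws k (#special (remove i U)) (#ordinary (remove i U)) (g ∘ (𝟙[ special i ] +_))
        ∎

  Exhausted : Pool → Set
  Exhausted V = ∀ i → ¬ T (V i)

  remove-⊆ : ∀ i U j → T (remove i U j) → T (U j)
  remove-⊆ i U j p with i ≟ j
  ... | no _ = p

  drawable-⊆ : ∀ V w → T (drawable V w) → ∀ j → j ∈ w → T (V j)
  drawable-⊆ V (i ∷ w) d .i (here refl) = proj₁ (Equivalence.to T-∧ d)
  drawable-⊆ V (i ∷ w) d j  (there j∈w) =
    remove-⊆ i V j (drawable-⊆ (remove i V) w (proj₂ (Equivalence.to T-∧ d)) j j∈w)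

  drawable⇔ : ∀ V w → T (drawable V w) ⇔ (Unique w × (∀ j → j ∈ w → T (V j)))
  drawable⇔ V w = mk⇔ (λ d → unique V w d , drawable-⊆ V w d) (λ (u , w⊆V) → drawn V w u w⊆V)
    where
    unique : ∀ V w → T (drawable V w) → Unique w
    unique V []      _ = []
    unique V (i ∷ w) d = let (_ , d′) = Equivalence.to T-∧ d in
      All.tabulate (λ {j} j∈w i≡j → subst T (remove-self i V)
                                      (subst (T ∘ remove i V) (sym i≡j) (drawable-⊆ (remove i V) w d′ j j∈w)))
      ∷ unique (remove i V) w d′
    drawn : ∀ V w → Unique w → (∀ j → j ∈ w → T (V j)) → T (drawable V w)
    drawn V []      _        _    = _
    drawn V (i ∷ w) (i∉ ∷ u) w⊆V = Equivalence.from T-∧ (w⊆V i (here refl) ,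
      drawn (remove i V) w u (λ j j∈w → subst T (sym (remove-other i j V (All.lookup i∉ j∈w))) (w⊆V j (there j∈w))))

  ∖⇔ : ∀ V w j → T ((V ∖ w) j) ⇔ (T (V j) × j ∉ w)
  ∖⇔ V w j = mk⇔ (to V w) (λ (Vj , j∉w) → from V w Vj j∉w)
    where
    to : ∀ V w → T ((V ∖ w) j) → T (V j) × j ∉ w
    to V []      p = p , λ ()
    to V (i ∷ w) p with to (remove i V) w p
    ... | Rj , j∉w = remove-⊆ i V j Rj , λ where
      (here refl)  → subst T (remove-self i V) Rj
      (there j∈w) → j∉w j∈w
    from : ∀ V w → T (V j) → j ∉ w → T ((V ∖ w) j)
    from V []      Vj _   = Vj
    from V (i ∷ w) Vj j∉ = from (remove i V) w
      (subst T (sym (remove-other i j V (λ i≡j → j∉ (here (sym i≡j))))) Vj) (j∉ ∘ there)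

  drawable-++ : ∀ V b w → drawable V (b ++ w) ≡ drawable V b ∧ drawable (V ∖ b) w
  drawable-++ V []      w = refl
  drawable-++ V (i ∷ b) w = trans (cong (V i ∧_) (drawable-++ (remove i V) b w)) (sym (∧-assoc (V i) _ _))

  ∖-++ : ∀ V b w → V ∖ (b ++ w) ≡ V ∖ b ∖ w
  ∖-++ V []      w = refl
  ∖-++ V (i ∷ b) w = ∖-++ (remove i V) b w

  exhausted⇔ : ∀ U → T (#special U + #ordinary U ≡ᵇ 0) ⇔ Exhausted U
  exhausted⇔ U = mk⇔ (Equivalence.to (count≡0⇔ U) ∘ trans (sym split) ∘ ℕP.≡ᵇ⇒≡ _ 0)
                     (ℕP.≡⇒≡ᵇ _ 0 ∘ trans split ∘ Equivalence.from (count≡0⇔ U))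
    where
    split : #special U + #ordinary U ≡ count U
    split = trans (sym (∑-distrib-+ (λ i → 𝟙[ U i ∧ special i ]) (λ i → 𝟙[ U i ∧ not (special i) ])))
                  (sum-cong-≗ (λ i → 𝟙-split (U i) (special i)))
      where
      𝟙-split : ∀ a b → 𝟙[ a ∧ b ] + 𝟙[ a ∧ not b ] ≡ 𝟙[ a ]
      𝟙-split true  true  = refl
      𝟙-split true  false = refl
      𝟙-split false _     = refl

  module _ (S : ℕ → Bool) where

    -- A form of IsDOP relative to the pool U of unused labels, checked block by block.
    valid : Pool → List (List (Fin m)) → Bool
    valid U []       = #special U + #ordinary U ≡ᵇ 0
    valid U (b ∷ bs) = S (length b) ∧ drawable U b ∧ (specials r b ≤ᵇ 1) ∧ valid (U ∖ b) bs

    sumOver-valid : ∀ cs U → ∑[ bs ∈ prod (map (words m) cs) ] 𝟙[ valid U bs ] ≡ fillings S cs (#special U) (#ordinary U)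
    sumOver-valid []       U = ℕP.+-identityʳ _
    sumOver-valid (c ∷ cs) U = begin
      sumOver (concatMap (λ b → map (b ∷_) rest) (words m c)) (λ bs → 𝟙[ valid U bs ])
        ≡⟨ sumOver-concatMap _ (λ b → map (b ∷_) rest) (words m c) ⟩
      ∑[ b ∈ words m c ] sumOver (map (b ∷_) rest) (λ bs → 𝟙[ valid U bs ])
        ≡⟨ sumOver-cong startingWith (words m c) ⟩
      ∑[ b ∈ words m c ] (𝟙[ S (length b) ] * continuations b)
        ≡⟨ sumOver-words-length c (λ l b → 𝟙[ S l ] * continuations b) ⟩
      ∑[ b ∈ words m c ] (𝟙[ S c ] * continuations b)
        ≡⟨ sumOver-*ˡ 𝟙[ S c ] continuations (words m c) ⟩
      𝟙[ S c ] * sumOver (words m c) continuations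
        ≡⟨ cong (𝟙[ S c ] *_) (sumOver-words c U (λ j p q → 𝟙[ j ≤ᵇ 1 ] * fillings S cs p q)) ⟩
      fillings S (c ∷ cs) (#special U) (#ordinary U)
        ∎
      where
      open ≡-Reasoning
      rest : List (List (List (Fin m)))
      rest = prod (map (words m) cs)
      continuations : List (Fin m) → ℕ
      continuations b =
        𝟙[ drawable U b ] * (𝟙[ specials r b ≤ᵇ 1 ] * fillings S cs (#special (U ∖ b)) (#ordinary (U ∖ b)))
      startingWith : ∀ b → sumOver (map (b ∷_) rest) (λ bs → 𝟙[ valid U bs ]) ≡ 𝟙[ S (length b) ] * continuations b
      startingWith b = begin
        sumOver (map (b ∷_) rest) (λ bs → 𝟙[ valid U bs ])
          ≡⟨ sumOver-map _ (b ∷_) rest ⟩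
        ∑[ bs ∈ rest ] 𝟙[ valid U (b ∷ bs) ]
          ≡⟨ sumOver-𝟙-∧ (S (length b)) _ rest ⟩
        𝟙[ S (length b) ] * ∑[ bs ∈ rest ] 𝟙[ drawable U b ∧ (specials r b ≤ᵇ 1) ∧ valid (U ∖ b) bs ]
          ≡⟨ cong (𝟙[ S (length b) ] *_) (trans (sumOver-𝟙-∧ (drawable U b) _ rest)
                                          (cong (𝟙[ drawable U b ] *_) (sumOver-𝟙-∧ (specials r b ≤ᵇ 1) _ rest))) ⟩
        𝟙[ S (length b) ] * (𝟙[ drawable U b ] * (𝟙[ specials r b ≤ᵇ 1 ] * ∑[ bs ∈ rest ] 𝟙[ valid (U ∖ b) bs ]))
          ≡⟨ cong (λ n → 𝟙[ S (length b) ] * (𝟙[ drawable U b ] * (𝟙[ specials r b ≤ᵇ 1 ] * n)))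
                  (sumOver-valid cs (U ∖ b)) ⟩
        𝟙[ S (length b) ] * continuations b
          ∎

    Valid : Pool → List (List (Fin m)) → Set
    Valid U bs =
      All (T ∘ S ∘ length) bs × All (λ b → specials r b ≤ 1) bs × T (drawable U (concat bs)) × Exhausted (U ∖ concat bs)

    valid⇔ : ∀ U bs → T (valid U bs) ⇔ Valid U bs
    valid⇔ U bs = mk⇔ (to U bs) (from U bs)
      where
      ∧⁻ : ∀ {a b} → T (a ∧ b) → T a × T b
      ∧⁻ = Equivalence.to T-∧
      ∧⁺ : ∀ {a b} → T a → T b → T (a ∧ b)
      ∧⁺ p q = Equivalence.from T-∧ (p , q)
      to : ∀ U bs → T (valid U bs) → Valid U bs
      to U []       v = [] , [] , _ , Equivalence.to (exhausted⇔ U) v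
      to U (b ∷ bs) v =
        let (s , v₁) = ∧⁻ v ; (d , v₂) = ∧⁻ v₁ ; (o , v₃) = ∧⁻ v₂
            (ss , os , ds , e) = to (U ∖ b) bs v₃
        in s ∷ ss , ℕP.≤ᵇ⇒≤ _ 1 o ∷ os ,
           subst T (sym (drawable-++ U b (concat bs))) (∧⁺ d ds) ,
           subst Exhausted (sym (∖-++ U b (concat bs))) e
      from : ∀ U bs → Valid U bs → T (valid U bs)
      from U []       (_ , _ , _ , e) = Equivalence.from (exhausted⇔ U) e
      from U (b ∷ bs) (s ∷ ss , o ∷ os , d , e) =
        let (d₁ , d₂) = ∧⁻ (subst T (drawable-++ U b (concat bs)) d)
        in ∧⁺ s (∧⁺ d₁ (∧⁺ (ℕP.≤⇒≤ᵇ o)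
                (from (U ∖ b) bs (ss , os , d₂ , subst Exhausted (∖-++ U b (concat bs)) e))))

    full : Pool
    full _ = true

    IsDOP⇔valid : S 0 ≡ false → ∀ bs → IsDOP S r m bs ⇔ T (valid full bs)
    IsDOP⇔valid S0 bs = mk⇔ to from
      where
      open import Data.List.Membership.DecPropositional (_≟_ {m}) using (_∈?_)
      to : IsDOP S r m bs → T (valid full bs)
      to (_ , uq , cover , sizes , specials≤1) = Equivalence.from (valid⇔ full bs)
        ( All.map (Equivalence.from T-≡) sizes
        , specials≤1
        , Equivalence.from (drawable⇔ full (concat bs)) (uq , λ _ _ → _)
        , λ i left → proj₂ (Equivalence.to (∖⇔ full (concat bs) i) left) (cover i))
      nonExhausted : ∀ {b} → T (S (length b)) → NonEmpty b
      nonExhausted {[]}    s = ⊥-elim (subst T S0 s)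
      nonExhausted {_ ∷ _} _ = s≤s z≤n
      from : T (valid full bs) → IsDOP S r m bs
      from v with Equivalence.to (valid⇔ full bs) v
      ... | sizes , specials≤1 , d , e =
          All.map (λ {b} → nonExhausted {b}) sizes
        , proj₁ (Equivalence.to (drawable⇔ full (concat bs)) d)
        , (λ i → decidable-stable (i ∈? concat bs) (λ i∉ → e i (Equivalence.from (∖⇔ full (concat bs) i) (_ , i∉))))
        , All.map (Equivalence.to T-≡) sizes
        , specials≤1

module _ (S : ℕ → Bool) (S0 : S 0 ≡ false) where

  𝒟≡dopCount : ∀ n r → 𝒟 n S r ≡ dopCount S r n
  𝒟≡dopCount n r = begin
    length (filter (isDOP? S r m) (candidates m))
      ≡⟨ length-filter (isDOP? S r m) (candidates m) ⟩
    ∑[ bs ∈ candidates m ] 𝟙[ does (isDOP? S r m bs) ]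
      ≡⟨ sumOver-concatMap _ (λ c → prod (map (words m) c)) (comps m) ⟩
    ∑[ c ∈ comps m ] ∑[ bs ∈ prod (map (words m) c) ] 𝟙[ does (isDOP? S r m bs) ]
      ≡⟨ sumOver-cong (λ c → trans (sumOver-cong checker (prod (map (words m) c))) (sumOver-valid r m S c (full r m S)))
                      (comps m) ⟩
    ∑[ c ∈ comps m ] fillings S c (#special r m (full r m S)) (#ordinary r m (full r m S))
      ≡⟨ cong₂ (λ p q → ∑[ c ∈ comps m ] fillings S c p q) #special-full #ordinary-full ⟩
    ∑[ c ∈ comps m ] fillings S c r n
      ∎
    where
    open ≡-Reasoning
    m : ℕ
    m = n + r
    checker : ∀ bs → 𝟙[ does (isDOP? S r m bs) ] ≡ 𝟙[ valid r m S (full r m S) bs ]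
    checker bs = cong 𝟙[_] (does-⇔ (isDOP? S r m bs) (IsDOP⇔valid r m S S0 bs))
    #special-full : #special r m (full r m S) ≡ r
    #special-full = trans (count-toℕ< m r) (ℕP.m≥n⇒m⊓n≡n (ℕP.m≤n+m r n))
    #ordinary-full : #ordinary r m (full r m S) ≡ n
    #ordinary-full = trans (count-toℕ≮ m r) (ℕP.m+n∸n≡m n r)

  sumS≗χ : sumS S ≗ fromℕ ∘ χ S
  sumS≗χ k with S k
  ... | true  = refl
  ... | false = refl

  dsumS≗χ′ : dsumS S ≗ fromℕ ∘ χ′ S
  dsumS≗χ′ k with S (suc k)
  ... | true  = cong fromℕ (sym (ℕP.+-identityʳ (suc k)))
  ... | false = refl

  egf-δ-zero : egf (δ 0) ≗ one
  egf-δ-zero zero    = refl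
  egf-δ-zero (suc n) = ℚP.0/n≡0 (suc n !) {{suc n !≢0}}

  egf-δ-suc : ∀ r n → egf (δ (suc r)) n ≡ ℚ.0ℚ
  egf-δ-suc r n = ℚP.0/n≡0 (n !) {{n !≢0}}

  egf-dopCount-rec : ∀ r → egf (dopCount S r)
    ≗ (egf (δ r) ⊕ (sumS S ⊛ egf (dopCount S r))) ⊕ (fromℕ r · (dsumS S ⊛ egf (dopCount S (r ∸ 1))))
  egf-dopCount-rec r n = begin
    egf (dopCount S r) n
      ≡⟨ egf-cong (dopCount-rec S S0 r) n ⟩
    egf (λ q → δ r q + (χ S ⋆ dopCount S r) q + r ℕ.* (χ′ S ⋆ dopCount S (r ∸ 1)) q) n
      ≡⟨ egf-+ (λ q → δ r q + (χ S ⋆ dopCount S r) q) (λ q → r ℕ.* (χ′ S ⋆ dopCount S (r ∸ 1)) q) n ⟩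
    egf (λ q → δ r q + (χ S ⋆ dopCount S r) q) n ℚ.+ egf (λ q → r ℕ.* (χ′ S ⋆ dopCount S (r ∸ 1)) q) n
      ≡⟨ cong₂ ℚ._+_ (egf-+ (δ r) (χ S ⋆ dopCount S r) n) (egf-* r (χ′ S ⋆ dopCount S (r ∸ 1)) n) ⟩
    egf (δ r) n ℚ.+ egf (χ S ⋆ dopCount S r) n ℚ.+ fromℕ r ℚ.* egf (χ′ S ⋆ dopCount S (r ∸ 1)) n
      ≡⟨ cong₂ (λ x y → egf (δ r) n ℚ.+ x ℚ.+ fromℕ r ℚ.* y)
               (trans (egf-⋆ (χ S) (dopCount S r) n) (⊛-congˡ (egf (dopCount S r)) (λ k → sym (sumS≗χ k)) n))
               (trans (egf-⋆ (χ′ S) (dopCount S (r ∸ 1)) n)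
                      (⊛-congˡ (egf (dopCount S (r ∸ 1))) (λ k → sym (dsumS≗χ′ k)) n)) ⟩
    egf (δ r) n ℚ.+ (sumS S ⊛ egf (dopCount S r)) n ℚ.+ fromℕ r ℚ.* (dsumS S ⊛ egf (dopCount S (r ∸ 1))) n
      ∎
    where open ≡-Reasoning

  egf-dopCount-rec₀ : egf (dopCount S 0) ≗ one ⊕ (sumS S ⊛ egf (dopCount S 0))
  egf-dopCount-rec₀ n = begin
    egf (dopCount S 0) n                ≡⟨ egf-dopCount-rec 0 n ⟩
    egf (δ 0) n ℚ.+ X ℚ.+ ℚ.0ℚ ℚ.* Y    ≡⟨ cong (λ x → x ℚ.+ X ℚ.+ ℚ.0ℚ ℚ.* Y) (egf-δ-zero n) ⟩
    one n ℚ.+ X ℚ.+ ℚ.0ℚ ℚ.* Y          ≡⟨ vanish (one n) X Y ⟩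
    one n ℚ.+ X                         ∎
    where
    open ≡-Reasoning
    X Y : ℚ
    X = (sumS S ⊛ egf (dopCount S 0)) n
    Y = (dsumS S ⊛ egf (dopCount S 0)) n
    vanish : ∀ x y z → x ℚ.+ y ℚ.+ ℚ.0ℚ ℚ.* z ≡ x ℚ.+ y
    vanish = solve-∀ ℚ-ring

  egf-dopCount-rec₊ : ∀ r → egf (dopCount S (suc r))
    ≗ (fromℕ (suc r) · (dsumS S ⊛ egf (dopCount S r))) ⊕ (sumS S ⊛ egf (dopCount S (suc r)))
  egf-dopCount-rec₊ r n = begin
    egf (dopCount S (suc r)) n          ≡⟨ egf-dopCount-rec (suc r) n ⟩
    egf (δ (suc r)) n ℚ.+ X ℚ.+ Y       ≡⟨ cong (λ x → x ℚ.+ X ℚ.+ Y) (egf-δ-suc r n) ⟩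
    ℚ.0ℚ ℚ.+ X ℚ.+ Y                    ≡⟨ rearrange X Y ⟩
    Y ℚ.+ X                             ∎
    where
    open ≡-Reasoning
    X Y : ℚ
    X = (sumS S ⊛ egf (dopCount S (suc r))) n
    Y = fromℕ (suc r) ℚ.* (dsumS S ⊛ egf (dopCount S r)) n
    rearrange : ∀ x y → ℚ.0ℚ ℚ.+ x ℚ.+ y ≡ y ℚ.+ x
    rearrange = solve-∀ ℚ-ring

mainTheorem16 : (S : ℕ → Bool) → S 0 ≡ false → (r : ℕ) →
    (n : ℕ) →
    (egf𝒟 S r ⊛ ((one ⊖ sumS S) ^ˢ suc r)) n
    ≡ (const (fromℕ (r !)) ⊛ (dsumS S ^ˢ r)) n
mainTheorem16 S S0 r n = begin
  (egf𝒟 S r ⊛ B^[1+r]) n                      ≡⟨ ⊛-congˡ B^[1+r] (egf-cong (λ n → 𝒟≡dopCount S S0 n r)) n ⟩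
  (egf (dopCount S r) ⊛ B^[1+r]) n            ≡⟨ ⊛-[one⊖]^-closedForm (sumS S) (dsumS S) (egf ∘ dopCount S)
                                                   (egf-dopCount-rec₀ S S0) (egf-dopCount-rec₊ S S0) r n ⟩
  (fromℕ (r !) · (dsumS S ^ˢ r)) n            ≡⟨ ⊛-constˡ (fromℕ (r !)) (dsumS S ^ˢ r) n ⟨
  (const (fromℕ (r !)) ⊛ (dsumS S ^ˢ r)) n    ∎
  where
  open ≡-Reasoning
  B^[1+r] : FPS
  B^[1+r] = (one ⊖ sumS S) ^ˢ suc r
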